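{- For all graphs $G,H$ and every $d\in\mathbb{N}$, there is a graph homomorphism $(G\ast H)\ltimes d\to (G\ltimes d)\ast H$. Moreover, there exist graphs $G,H$ and $d$ such that there is no graph homomorphism $(G\ltimes d)\ast H\to (G\ast H)\ltimes d$.
   Context: Graphs are undirected simple graphs, possibly infinite. The disjunctive product $G\ast H$ has vertex set $V(G)\times V(H)$ with $(v,w)\sim(v',w')$ iff $v\sim v'$ or $w\sim w'$. The lexicographic product $G\ltimes H$ has vertex set $V(G)\times V(H)$ with $(v,w)\sim(v',w')$ iff $v\sim v'$, or $v=v'$ and $w\sim w'$. The $d$-fold blowup is $G\ltimes d:=G\ltimes K_d$, where $K_d$ is the complete graph on $d$ vertices. -}

module Defs where

open import Data.Nat using (ℕ)
open import Data.Fin using (Fin)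
open import Data.Product using (Σ; _×_; _,_; proj₁; proj₂)
open import Data.Sum using (_⊎_)
open import Relation.Nullary using (¬_)
open import Relation.Binary.PropositionalEquality using (_≡_; _≢_)

record Graph : Set₁ where
  field
    V     : Set
    Adj   : V → V → Set
    sym   : ∀ {x y} → Adj x y → Adj y x
    irrefl : ∀ {x} → ¬ Adj x x
open Graph public

Hom : Graph → Graph → Set
Hom G H = Σ (V G → V H) λ f → ∀ {x y} → Adj G x y → Adj H (f x) (f y)

K : ℕ → Graph
K d = record
  { V = Fin d
  ; Adj = λ i j → i ≢ j
  ; sym = λ p q → p (Relation.Binary.PropositionalEquality.sym q)
  ; irrefl = λ p → p Relation.Binary.PropositionalEquality.refl
  }

_∗_ : Graph → Graph → Graph
G ∗ H = record
  { V = V G × V H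
  ; Adj = λ p q → Adj G (proj₁ p) (proj₁ q) ⊎ Adj H (proj₂ p) (proj₂ q)
  ; sym = λ { (Data.Sum.inj₁ a) → Data.Sum.inj₁ (sym G a)
            ; (Data.Sum.inj₂ b) → Data.Sum.inj₂ (sym H b) }
  ; irrefl = λ { (Data.Sum.inj₁ a) → irrefl G a ; (Data.Sum.inj₂ b) → irrefl H b }
  }

_⋉_ : Graph → Graph → Graph
G ⋉ H = record
  { V = V G × V H
  ; Adj = λ p q → Adj G (proj₁ p) (proj₁ q) ⊎ (proj₁ p ≡ proj₁ q × Adj H (proj₂ p) (proj₂ q))
  ; sym = λ { (Data.Sum.inj₁ a) → Data.Sum.inj₁ (sym G a)
            ; (Data.Sum.inj₂ (e , b)) → Data.Sum.inj₂ (Relation.Binary.PropositionalEquality.sym e , sym H b) }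
  ; irrefl = λ { (Data.Sum.inj₁ a) → irrefl G a ; (Data.Sum.inj₂ (_ , b)) → irrefl H b }
  }

blowup : Graph → ℕ → Graph
blowup G d = G ⋉ K d

-- Sending ((v , w) , i) to ((v , i) , w) is a homomorphism (G ∗ H) ⋉ F → (G ⋉ F) ∗ H for
-- every graph F: two copies of one vertex (v , w) stay two copies of v in G ⋉ F.
-- For the converse take G = K₁, H = C₅, d = 2. The graph (K₁ ⋉ 2) ∗ C₅ is two copies of C₅
-- joined completely; each copy needs three colours and the copies share none, so it is not
-- 5-colourable. But (K₁ ∗ C₅) ⋉ 2 maps onto C₅ ⋉ 2, which is 5-coloured by (x , j) ↦ 2x + j mod 5.
module Submission where

open import Defs hiding (sym)
open import Data.Nat using (ℕ; suc; _+_; _*_; _≤_)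
open import Data.Nat.Properties using (<-irrefl)
open import Data.Nat.DivMod using (_mod_)
open import Data.Fin using (Fin; toℕ; splitAt; join)
open import Data.Fin.Patterns using (0F; 1F; 2F; 3F; 4F)
open import Data.Fin.Properties using (_≟_; all?; injective⇒≤; join-splitAt)
open import Data.Vec.Functional using ([]; _∷_)
open import Data.Product using (_×_; Σ; _,_; proj₁; proj₂)
open import Data.Sum using (_⊎_; inj₁; inj₂; [_,_]′; swap)
open import Data.Empty using (⊥-elim)
open import Function using (_∘_; Injective)
open import Relation.Nullary using (¬_; Dec; yes; no; ¬?; contradiction)
open import Relation.Nullary.Decidable using (toWitness; _⊎-dec_; _×-dec_; _→-dec_)
open import Relation.Binary.PropositionalEquality using (_≡_; _≢_; refl; sym; trans; cong)

distinct₃⇒injective : ∀ {A : Set} (f : Fin 3 → A) →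
                      f 0F ≢ f 1F → f 1F ≢ f 2F → f 0F ≢ f 2F → Injective _≡_ _≡_ f
distinct₃⇒injective f p₀₁ p₁₂ p₀₂ {0F} {0F} _ = refl
distinct₃⇒injective f p₀₁ p₁₂ p₀₂ {0F} {1F} e = contradiction e p₀₁
distinct₃⇒injective f p₀₁ p₁₂ p₀₂ {0F} {2F} e = contradiction e p₀₂
distinct₃⇒injective f p₀₁ p₁₂ p₀₂ {1F} {0F} e = contradiction (sym e) p₀₁
distinct₃⇒injective f p₀₁ p₁₂ p₀₂ {1F} {1F} _ = refl
distinct₃⇒injective f p₀₁ p₁₂ p₀₂ {1F} {2F} e = contradiction e p₁₂
distinct₃⇒injective f p₀₁ p₁₂ p₀₂ {2F} {0F} e = contradiction (sym e) p₀₂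
distinct₃⇒injective f p₀₁ p₁₂ p₀₂ {2F} {1F} e = contradiction (sym e) p₁₂
distinct₃⇒injective f p₀₁ p₁₂ p₀₂ {2F} {2F} _ = refl

[,]-injective : ∀ {A B C : Set} {f : A → C} {g : B → C} →
                Injective _≡_ _≡_ f → Injective _≡_ _≡_ g → (∀ x y → f x ≢ g y) →
                Injective _≡_ _≡_ [ f , g ]′
[,]-injective f-inj g-inj disjoint {inj₁ x} {inj₁ x′} e = cong inj₁ (f-inj e)
[,]-injective f-inj g-inj disjoint {inj₁ x} {inj₂ y}  e = contradiction e (disjoint x y)
[,]-injective f-inj g-inj disjoint {inj₂ y} {inj₁ x}  e = contradiction (sym e) (disjoint x y)
[,]-injective f-inj g-inj disjoint {inj₂ y} {inj₂ y′} e = cong inj₂ (g-inj e)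

disjoint-injections⇒≤ : ∀ {m n k} {f : Fin m → Fin k} {g : Fin n → Fin k} →
                        Injective _≡_ _≡_ f → Injective _≡_ _≡_ g → (∀ x y → f x ≢ g y) →
                        m + n ≤ k
disjoint-injections⇒≤ {m} {n} f-inj g-inj disjoint =
  injective⇒≤ (splitAt-injective ∘ [,]-injective f-inj g-inj disjoint)
  where
  splitAt-injective : Injective _≡_ _≡_ (splitAt m {n})
  splitAt-injective {i} {j} e =
    trans (sym (join-splitAt m n i)) (trans (cong (join m n) e) (join-splitAt m n j))

Colouring : Graph → ℕ → Set
Colouring G k = Hom G (K k)

pullback : ∀ F G {k} → Colouring G k → Hom F G → Colouring F k
pullback F G (c , c-hom) (f , f-hom) = c ∘ f , c-hom ∘ f-hom

∗-⋉-interchange : ∀ G H F → Hom ((G ∗ H) ⋉ F) ((G ⋉ F) ∗ H)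
∗-⋉-interchange G H F = regroup , preserves
  where
  regroup : V ((G ∗ H) ⋉ F) → V ((G ⋉ F) ∗ H)
  regroup ((v , w) , i) = (v , i) , w
  preserves : ∀ {x y} → Adj ((G ∗ H) ⋉ F) x y → Adj ((G ⋉ F) ∗ H) (regroup x) (regroup y)
  preserves (inj₁ (inj₁ v~v′))    = inj₁ (inj₁ v~v′)
  preserves (inj₁ (inj₂ w~w′))    = inj₂ w~w′
  preserves (inj₂ (vw≡vw′ , i~j)) = inj₁ (inj₂ (cong proj₁ vw≡vw′ , i~j))

∗-proj₂ : ∀ G H → (∀ {x y} → ¬ Adj G x y) → Hom (G ∗ H) H
∗-proj₂ G H edgeless = (λ { (_ , w) → w }) , λ { (inj₁ e) → ⊥-elim (edgeless e) ; (inj₂ e) → e }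

⋉-mapˡ : ∀ G G′ F → Hom G G′ → Hom (G ⋉ F) (G′ ⋉ F)
⋉-mapˡ G G′ F (f , f-hom) =
  (λ { (v , i) → f v , i }) ,
  λ { (inj₁ e) → inj₁ (f-hom e) ; (inj₂ (eq , i~j)) → inj₂ (cong f eq , i~j) }

K₁-edgeless : ∀ {x y} → ¬ Adj (K 1) x y
K₁-edgeless {0F} {0F} 0≢0 = 0≢0 refl

module Layers (G H F : Graph) {d : ℕ} (c : Hom (blowup G d ∗ H) F) where

  layer : V G → Fin d → Hom H F
  layer v i = (λ x → proj₁ c ((v , i) , x)) , proj₂ c ∘ inj₂

  layers-adjacent : ∀ v {i j} → i ≢ j → ∀ x y → Adj F (proj₁ (layer v i) x) (proj₁ (layer v j) y)
  layers-adjacent v i≢j x y = proj₂ c (inj₁ (inj₂ (refl , i≢j)))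

cyclic-step : Fin 5 → Fin 5
cyclic-step x = suc (toℕ x) mod 5

cyclic-step-has-no-fixed-point : ∀ x → cyclic-step x ≢ x
cyclic-step-has-no-fixed-point = toWitness {a? = all? λ x → ¬? (cyclic-step x ≟ x)} _

C₅ : Graph
C₅ = record
  { V      = Fin 5
  ; Adj    = λ x y → cyclic-step x ≡ y ⊎ cyclic-step y ≡ x
  ; sym    = swap
  ; irrefl = λ {x} → [ cyclic-step-has-no-fixed-point x , cyclic-step-has-no-fixed-point x ]′
  }

C₅-adjacent? : ∀ x y → Dec (Adj C₅ x y)
C₅-adjacent? x y = cyclic-step x ≟ y ⊎-dec cyclic-step y ≟ x

C₅-colouring-injective-on-three : ∀ {k} (c : Colouring C₅ k) →
                                  Σ (Fin 3 → Fin 5) λ s → Injective _≡_ _≡_ (proj₁ c ∘ s)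
C₅-colouring-injective-on-three (c , c-hom) with c 0F ≟ c 2F
... | no c₀≢c₂ =
  (0F ∷ 1F ∷ 2F ∷ []) , distinct₃⇒injective _ (c-hom (inj₁ refl)) (c-hom (inj₁ refl)) c₀≢c₂
... | yes c₀≡c₂ with c 2F ≟ c 4F
...   | no c₂≢c₄ =
  (2F ∷ 3F ∷ 4F ∷ []) , distinct₃⇒injective _ (c-hom (inj₁ refl)) (c-hom (inj₁ refl)) c₂≢c₄
...   | yes c₂≡c₄ = contradiction (sym (trans c₀≡c₂ c₂≡c₄)) (c-hom {4F} {0F} (inj₁ refl))

C₅-blowup-colouring : Colouring (blowup C₅ 2) 5
C₅-blowup-colouring = colour , λ {p} {q} → proper p q
  where
  colour : Fin 5 × Fin 2 → Fin 5
  colour (x , j) = (2 * toℕ x + toℕ j) mod 5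
  proper : ∀ p q → Adj (blowup C₅ 2) p q → colour p ≢ colour q
  proper (x , i) (y , j) = toWitness {a? = all? λ x → all? λ y → all? λ i → all? λ j →
    (C₅-adjacent? x y ⊎-dec (x ≟ y ×-dec ¬? (i ≟ j))) →-dec ¬? (colour (x , i) ≟ colour (y , j))} _ x y i j

blowup₂-∗-C₅-colouring⇒6≤ : ∀ G {k} → Colouring (blowup G 2 ∗ C₅) k → V G → 6 ≤ k
blowup₂-∗-C₅-colouring⇒6≤ G {k} c v =
  disjoint-injections⇒≤ (proj₂ (C₅-colouring-injective-on-three (layer v 0F)))
                        (proj₂ (C₅-colouring-injective-on-three (layer v 1F)))
                        (λ _ _ → layers-adjacent v (λ ()) _ _)
  where open Layers G C₅ (K k) c

lemma3p9 : ((G H : Graph) (d : ℕ) → Hom (blowup (G ∗ H) d) (blowup G d ∗ H))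
           × Σ Graph (λ G → Σ Graph (λ H → Σ ℕ (λ d → ¬ Hom (blowup G d ∗ H) (blowup (G ∗ H) d))))
lemma3p9 = (λ G H d → ∗-⋉-interchange G H (K d)) , K 1 , C₅ , 2 , no-hom
  where
  L R : Graph
  L = blowup (K 1) 2 ∗ C₅
  R = blowup (K 1 ∗ C₅) 2
  R-colouring : Colouring R 5
  R-colouring = pullback R (blowup C₅ 2) C₅-blowup-colouring
                  (⋉-mapˡ (K 1 ∗ C₅) C₅ (K 2) (∗-proj₂ (K 1) C₅ K₁-edgeless))
  no-hom : ¬ Hom L R
  no-hom f = <-irrefl refl (blowup₂-∗-C₅-colouring⇒6≤ (K 1) (pullback L R R-colouring f) 0F)
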